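{- Let $G=(V,A)$ be a flow graph with start vertex $s$, let $T$ be a rooted tree with the parent property, and let $v\neq s$. If $x$ is a vertex on a simple path $P$ in $G$ from $t(v)$ to $v$, then $x$ is a descendant of $t(v)$ in $T$ but not a proper descendant of $v$ in $T$.
   Context: A flow graph is a finite directed graph $G=(V,A)$ with start vertex $s$ such that every vertex is reachable from $s$; there are no arcs entering $s$. For a rooted tree $T$ with vertex set contained in $V$, $t(v)$ denotes the parent of $v$; ancestors and descendants include the vertex itself. $T$ has the parent property if for every arc $(v,w)\in A$, $t(w)$ is an ancestor of $v$ in $T$. -}

module Defs where

open import Level using (0ℓ)
open import Data.Nat using (ℕ)
open import Data.Fin using (Fin)
open import Data.Maybe using (Maybe; just; nothing)
open import Data.List using (List; []; _∷_)
open import Data.List.Relation.Unary.Unique.Propositional using (Unique)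
open import Data.Product using (_×_; ∃)
open import Relation.Binary using (Rel)
open import Relation.Binary.PropositionalEquality using (_≡_; _≢_)
open import Relation.Binary.Construct.Closure.ReflexiveTransitive using (Star)
open import Relation.Nullary using (¬_)

record FlowGraph (n : ℕ) : Set₁ where
  field
    Arc        : Rel (Fin n) 0ℓ
    start      : Fin n
    reachable  : ∀ v → Star Arc start v
    noEnter    : ∀ v → ¬ Arc v start

-- A rooted tree on the vertices Fin n, given by a parent map t.
-- t v ≡ nothing exactly for the root; every vertex reaches the root by
-- following parents (which makes the parent structure acyclic, i.e. a tree).
record RootedTree (n : ℕ) : Set where
  field
    root       : Fin n
    parent     : Fin n → Maybe (Fin n)
    rootNoPar  : parent root ≡ nothing
    onlyRoot   : ∀ v → parent v ≡ nothing → v ≡ root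
  ParentStep : Rel (Fin n) 0ℓ
  ParentStep x y = parent x ≡ just y
  field
    toRoot     : ∀ v → Star ParentStep v root

module _ {n : ℕ} (T : RootedTree n) where
  open RootedTree T

  Ancestor : Fin n → Fin n → Set
  Ancestor u v = Star ParentStep v u

  Descendant : Fin n → Fin n → Set
  Descendant x y = Ancestor y x

  ProperDescendant : Fin n → Fin n → Set
  ProperDescendant x y = Descendant x y × x ≢ y

ParentProperty : {n : ℕ} → FlowGraph n → RootedTree n → Set
ParentProperty G T =
  ∀ v w → FlowGraph.Arc G v w →
    ∃ λ p → RootedTree.parent T w ≡ just p × Ancestor T p v

data Path {n : ℕ} (G : FlowGraph n) : Fin n → Fin n → Set where
  []  : ∀ {a} → Path G a a
  _∷_ : ∀ {a b c} → FlowGraph.Arc G a b → Path G b c → Path G a c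

vertices : ∀ {n} {G : FlowGraph n} {a b} → Path G a b → List (Fin n)
vertices {a = a} []       = a ∷ []
vertices {a = a} (_ ∷ p)  = a ∷ vertices p

SimplePath : ∀ {n} {G : FlowGraph n} {a b} → Path G a b → Set
SimplePath p = Unique (vertices p)

module Submission where

-- Write u ⊴ w for "u is a descendant of w" in T.
--  (1) Trees: the parent map is functional, and t(v) is never a descendant
--      of v (following parents from v reaches the root without cycling).
--  (2) Parent property, backwards step: if (a,b) is an arc and b is a proper
--      descendant of u, then t(b) is a descendant of u and an ancestor of a,
--      so a ⊴ u as well.
--  (3) Walking a path backwards from its end with (2): if c ⊴ u and no vertex
--      of a path Q from b to c equals u, then every vertex of Q is ⊴ u.  For
--      a simple path starting at u this gives: every vertex is ⊴ u.
--  (4) Walking a simple path forwards from a start a that is not ⊴ v: by the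
--      contrapositive of (2) no vertex before v is ⊴ v, and v itself occurs
--      only at the end, so no vertex is a proper descendant of v.
-- The corollary applies (3) with u = t(v) (v ⊴ t(v) by one parent step) and
-- (4) with a = t(v), which is not ⊴ v by (1).

open import Defs
open import Data.Nat using (ℕ)
open import Data.Fin using (Fin)
open import Data.Fin.Properties using (_≟_)
open import Data.Maybe using (just)
open import Data.Maybe.Properties using (just-injective)
open import Data.Product using (_×_; _,_; proj₁; proj₂)
open import Data.Empty using (⊥-elim)
open import Data.List.Membership.Propositional using (_∈_)
open import Data.List.Relation.Unary.All using (All; []; _∷_; lookup)
open import Data.List.Relation.Unary.Any using (here; there)
open import Data.List.Relation.Unary.AllPairs using (_∷_)
open import Relation.Binary.PropositionalEquality using (_≡_; _≢_; refl; sym; trans)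
open import Relation.Binary.Construct.Closure.ReflexiveTransitive using (Star; ε; _◅_; _◅◅_)
open import Relation.Nullary using (¬_; yes; no)

module _ {n : ℕ} (T : RootedTree n) where
  open RootedTree T

  parent-functional : ∀ {x y z} → parent x ≡ just y → parent x ≡ just z → y ≡ z
  parent-functional px py = just-injective (trans (sym px) py)

  -- If t(x) = y, then y is not a descendant of x; by induction on a parent
  -- walk from x to the root (a cycle through x would never reach the root).
  parent-not-descendant : ∀ {x y} → parent x ≡ just y → ¬ Descendant T y x
  parent-not-descendant {x} = go (toRoot x)
    where
    go : ∀ {x y} → Star ParentStep x root → parent x ≡ just y → ¬ Descendant T y x
    go ε px _ with trans (sym px) rootNoPar
    ... | ()
    go (step ◅ walk) px y⊴x with parent-functional step px
    go (step ◅ walk) px ε              | refl = go walk px ε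
    go (step ◅ walk) px (step′ ◅ walk′) | refl = go walk step′ (walk′ ◅◅ (px ◅ ε))

module _ {n : ℕ} {G : FlowGraph n} where

  all-start : ∀ {P : Fin n → Set} {b c} (Q : Path G b c) → All P (vertices Q) → P b
  all-start []      (pb ∷ _) = pb
  all-start (_ ∷ _) (pb ∷ _) = pb

  end∈vertices : ∀ {b c} (Q : Path G b c) → c ∈ vertices Q
  end∈vertices []      = here refl
  end∈vertices (_ ∷ Q) = there (end∈vertices Q)

module _ {n : ℕ} (G : FlowGraph n) (T : RootedTree n) (pp : ParentProperty G T) where
  open RootedTree T
  open FlowGraph G

  -- (2) Descendancy propagates backwards along an arc into a proper
  -- descendant: t(b) ⊴ u lies above a, hence a ⊴ u.
  arc-into-proper-descendant : ∀ {a b u} → Arc a b →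
    Descendant T b u → b ≢ u → Descendant T a u
  arc-into-proper-descendant e ε b≢u = ⊥-elim (b≢u refl)
  arc-into-proper-descendant {a} {b} e (step ◅ tb⊴u) _ with pp a b e
  ... | p , pb , p-above-a with parent-functional T step pb
  ... | refl = p-above-a ◅◅ tb⊴u

  descendants-along-path : ∀ {u b c} (Q : Path G b c) →
    All (u ≢_) (vertices Q) → Descendant T c u →
    All (λ x → Descendant T x u) (vertices Q)
  descendants-along-path []      _            c⊴u = c⊴u ∷ []
  descendants-along-path {u} (e ∷ Q) (_ ∷ avoid) c⊴u =
    arc-into-proper-descendant e (all-start Q rest) (λ eq → all-start Q avoid (sym eq)) ∷ rest
    where
    rest : All (λ x → Descendant T x u) (vertices Q)
    rest = descendants-along-path Q avoid c⊴u

  -- (3') A simple path starting at u and ending in a descendant of u stays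
  -- among the descendants of u (only its start equals u).
  simple-path-from-ancestor : ∀ {u c} (Q : Path G u c) → SimplePath Q →
    Descendant T c u → All (λ x → Descendant T x u) (vertices Q)
  simple-path-from-ancestor []      _            _   = ε ∷ []
  simple-path-from-ancestor (_ ∷ Q) (avoid ∷ _) c⊴u = ε ∷ descendants-along-path Q avoid c⊴u

  no-proper-descendant-along-path : ∀ {a v} (Q : Path G a v) → SimplePath Q →
    ¬ Descendant T a v → All (λ x → ¬ ProperDescendant T x v) (vertices Q)
  no-proper-descendant-along-path []  _ a⋬v = ⊥-elim (a⋬v ε)
  no-proper-descendant-along-path {v = v} (_∷_ {b = b} e Q) (_ ∷ simple) a⋬v
    with b ≟ v
  ... | no b≢v = (λ pd → a⋬v (proj₁ pd))
      ∷ no-proper-descendant-along-path Q simple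
          (λ b⊴v → a⋬v (arc-into-proper-descendant e b⊴v b≢v))
  ... | yes refl = (λ pd → a⋬v (proj₁ pd)) ∷ end-only Q simple
    where
    -- By simplicity, a path from v to v is trivial.
    end-only : (Q : Path G v v) → SimplePath Q →
      All (λ x → ¬ ProperDescendant T x v) (vertices Q)
    end-only []       _            = (λ pd → proj₂ pd refl) ∷ []
    end-only (_ ∷ Q) (avoid ∷ _) = ⊥-elim (lookup avoid (end∈vertices Q) refl)

corollary4 : ∀ {n} (G : FlowGraph n) (T : RootedTree n) → ParentProperty G T →
    ∀ (v tv : Fin n) → v ≢ FlowGraph.start G → RootedTree.parent T v ≡ just tv →
    (P : Path G tv v) → SimplePath P →
    ∀ x → x ∈ vertices P →
    Descendant T x tv × ¬ ProperDescendant T x v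
corollary4 G T pp v tv _ tv-parent P simple x x∈P =
    lookup (simple-path-from-ancestor G T pp P simple (tv-parent ◅ ε)) x∈P
  , lookup (no-proper-descendant-along-path G T pp P simple
              (parent-not-descendant T tv-parent)) x∈P
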